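{- The theory of sufficiently random graphs recognizes coordinates.
   Context: Graphs are simple graphs in the language with one binary relation $E$ (adjacency). A graph is sufficiently random if it has at least three vertices and for every set $P$ of $2$ vertices and every vertex $u\notin P$ there is a vertex $v\ne u$ not adjacent to $u$ and adjacent to all vertices of $P$; the theory of sufficiently random graphs is the first-order theory axiomatizing these properties. An ideal $\mathcal I$ on $\mathbb N$ is atomless if $\mathcal P(\mathbb N)/\mathcal I$ is atomless. For structures $\mathcal M_n$ and an ideal $\mathcal I$, $\prod_n\mathcal M_n/\mathcal I$ is the set of classes of $\prod_n\mathcal M_n$ under $a\sim b\iff\{n:a(n)\ne b(n)\}\in\mathcal I$, with $E(a,b)$ iff $\{n:\neg E(\tilde a(n),\tilde b(n))\}\in\mathcal I$. For $S\subseteq\mathbb N$, $a=_S b$ means $\{n\in S:\tilde a(n)\ne\tilde b(n)\}\in\mathcal I$. A function $\Phi\colon\prod_n\mathcal M_n/\mathcal I\to\prod_n\mathcal N_n/\mathcal J$ is (isomorphically) coordinate-respecting if there is a Boolean algebra isomorphism $\alpha\colon\mathcal P(\mathbb N)/\mathcal I\to\mathcal P(\mathbb N)/\mathcal J$ such that $a=_S b$ implies $\Phi(a)=_{\alpha(S)}\Phi(b)$ for all $a,b,S$. A first-order theory $T$ recognizes coordinates if for all atomless ideals $\mathcal I,\mathcal J$ and all models $\mathcal M_n,\mathcal N_n$ of $T$, every isomorphism $\prod_n\mathcal M_n/\mathcal I\to\prod_n\mathcal N_n/\mathcal J$ is (isomorphically) coordinate-respecting. -}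

module Defs where

open import Level using (0ℓ)
open import Data.Nat using (ℕ)
open import Data.Product using (Σ; ∃; _×_; _,_)
open import Data.Sum using (_⊎_)
open import Relation.Nullary using (¬_)
open import Relation.Binary.PropositionalEquality using (_≡_; _≢_)
open import Relation.Unary using (Pred; ∅; U; _⊆_; ∁; _∪_; _∩_; _∖_)

Subset : Set₁
Subset = Pred ℕ 0ℓ

_Δ_ : Subset → Subset → Subset
S Δ T = (S ∖ T) ∪ (T ∖ S)

record IsIdeal (I : Pred Subset 0ℓ) : Set₁ where
  field
    empty    : I ∅
    downward : ∀ {S T} → S ⊆ T → I T → I S
    union    : ∀ {S T} → I S → I T → I (S ∪ T)
    proper   : ¬ I U

-- Equality and order in the quotient Boolean algebra P(ℕ)/I
_≈[_]_ : Subset → Pred Subset 0ℓ → Subset → Set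
S ≈[ I ] T = I (S Δ T)

_≤[_]_ : Subset → Pred Subset 0ℓ → Subset → Set
S ≤[ I ] T = I (S ∖ T)

Atomless : Pred Subset 0ℓ → Set₁
Atomless I = ∀ S → ¬ I S →
  Σ Subset λ T → (T ≤[ I ] S) × ¬ I T × ¬ (S ≤[ I ] T)

record Graph : Set₁ where
  field
    V     : Set
    E     : V → V → Set
    irrefl : ∀ {x} → ¬ E x x
    sym   : ∀ {x y} → E x y → E y x

open Graph public

record SufficientlyRandom (G : Graph) : Set where
  field
    threeVertices : Σ (V G) λ x → Σ (V G) λ y → Σ (V G) λ z →
                      x ≢ y × x ≢ z × y ≢ z
    extension : ∀ (p q u : V G) → p ≢ q → u ≢ p → u ≢ q →
                  Σ (V G) λ v → v ≢ u × ¬ E G u v × E G v p × E G v q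

-- Reduced products ∏ₙ Mₙ / I  (as setoid-structures on ∏ₙ Mₙ)

module _ (M : ℕ → Graph) (I : Pred Subset 0ℓ) where

  Prod : Set
  Prod = (n : ℕ) → V (M n)

  _∼_ : Prod → Prod → Set
  a ∼ b = I (λ n → a n ≢ b n)

  Eᴾ : Prod → Prod → Set
  Eᴾ a b = I (λ n → ¬ E (M n) (a n) (b n))

  EqOn : Subset → Prod → Prod → Set
  EqOn S a b = I (λ n → S n × a n ≢ b n)

-- Isomorphisms of reduced products (maps on representatives that
-- respect ∼, i.e. maps of the quotient)

record IsIsoRP (M N : ℕ → Graph) (I J : Pred Subset 0ℓ)
               (Φ : Prod M I → Prod N J) : Set where
  field
    respects   : ∀ a b → _∼_ M I a b → _∼_ N J (Φ a) (Φ b)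
    injective  : ∀ a b → _∼_ N J (Φ a) (Φ b) → _∼_ M I a b
    surjective : ∀ y → Σ (Prod M I) λ x → _∼_ N J (Φ x) y
    preservesE : ∀ a b → Eᴾ M I a b → Eᴾ N J (Φ a) (Φ b)
    reflectsE  : ∀ a b → Eᴾ N J (Φ a) (Φ b) → Eᴾ M I a b

-- Boolean algebra isomorphism P(ℕ)/I → P(ℕ)/J, given by a map on
-- representatives.
record IsBAIso (I J : Pred Subset 0ℓ) (α : Subset → Subset) : Set₁ where
  field
    respects   : ∀ S T → S ≈[ I ] T → α S ≈[ J ] α T
    injective  : ∀ S T → α S ≈[ J ] α T → S ≈[ I ] T
    surjective : ∀ T → Σ Subset λ S → α S ≈[ J ] T
    pres-∪     : ∀ S T → α (S ∪ T) ≈[ J ] (α S ∪ α T)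
    pres-∁     : ∀ S → α (∁ S) ≈[ J ] ∁ (α S)

CoordinateRespecting : (M N : ℕ → Graph) (I J : Pred Subset 0ℓ) →
  (Prod M I → Prod N J) → Set₁
CoordinateRespecting M N I J Φ =
  Σ (Subset → Subset) λ α → IsBAIso I J α ×
    (∀ a b S → EqOn M I S a b → EqOn N J (α S) (Φ a) (Φ b))

RecognizesCoordinatesSR : Set₁
RecognizesCoordinatesSR =
  ∀ (I J : Pred Subset 0ℓ) → IsIdeal I → IsIdeal J → Atomless I → Atomless J →
  ∀ (M N : ℕ → Graph) → (∀ n → SufficientlyRandom (M n)) →
  (∀ n → SufficientlyRandom (N n)) →
  ∀ (Φ : Prod M I → Prod N J) → IsIsoRP M N I J Φ →
  CoordinateRespecting M N I J Φ

-- In a sufficiently random graph, c ∈ {a, b} iff every common neighbour of a and b is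
-- adjacent to c.  Arguing coordinatewise, the same characterisation holds almost everywhere in
-- a reduced product, so an isomorphism Φ preserves and reflects "c agrees a.e. with a or b".
-- Fix p, q adjacent in every coordinate and let χ S be q on S and p off S: the elements a.e. in
-- {p, q} are exactly the χ S, and S ≤ T iff χ T ∈ {χ S, q}.  Hence α S = {n | Φ (χ S) n = Φ q n}
-- is an order isomorphism P(ℕ)/I → P(ℕ)/J, i.e. a Boolean algebra isomorphism.  If x and y are
-- adjacent, "Φ (x on S, y off S) agrees with Φ x on α S" passes from (x, y) to (x′, y) and to
-- (x, y′), because adjacency survives Φ as pointwise distinctness.  Starting from (q, p), which
-- holds by definition of α, it reaches (a, b) via (t, p) and (t, b) for a common neighbour t of
-- p and b; and a =_S b makes (a on S, b off S) equal to b.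

module Submission where

open import Defs hiding (sym)
open import Level using (0ℓ)
open import Axiom.ExcludedMiddle using (ExcludedMiddle)
open import Axiom.DoubleNegationElimination using (em⇒dne)
open import Data.Empty using (⊥; ⊥-elim)
open import Data.Nat using (ℕ)
open import Data.Product using (Σ; _×_; _,_; proj₁; proj₂)
open import Data.Sum using (_⊎_; inj₁; inj₂; [_,_]′)
open import Data.Unit using (tt)
open import Function using (_∘_; id)
open import Relation.Nullary using (¬_; yes; no)
open import Relation.Nullary.Decidable using (toSum)
open import Relation.Binary.PropositionalEquality using (_≡_; _≢_; refl; sym; trans; subst)
open import Relation.Unary using (Pred; ∅; U; _⊆_; ∁; _∪_; _∩_; _⇒_)

OneOf : {A : Set} → A → A → A → Set
OneOf x y z = x ≡ y ⊎ x ≡ z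

module _ {A : Set} where

  no-three-in-pair : {a₁ a₂ a₃ x y : A} → a₁ ≢ a₂ → a₁ ≢ a₃ → a₂ ≢ a₃ →
                     OneOf a₁ x y → OneOf a₂ x y → OneOf a₃ x y → ⊥
  no-three-in-pair d₁₂ _ _ (inj₁ e₁) (inj₁ e₂) _ = d₁₂ (trans e₁ (sym e₂))
  no-three-in-pair d₁₂ _ _ (inj₂ e₁) (inj₂ e₂) _ = d₁₂ (trans e₁ (sym e₂))
  no-three-in-pair _ d₁₃ _ (inj₁ e₁) (inj₂ _) (inj₁ e₃) = d₁₃ (trans e₁ (sym e₃))
  no-three-in-pair _ _ d₂₃ (inj₁ _) (inj₂ e₂) (inj₂ e₃) = d₂₃ (trans e₂ (sym e₃))
  no-three-in-pair _ _ d₂₃ (inj₂ _) (inj₁ e₂) (inj₁ e₃) = d₂₃ (trans e₂ (sym e₃))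
  no-three-in-pair _ d₁₃ _ (inj₂ e₁) (inj₁ _) (inj₂ e₃) = d₁₃ (trans e₁ (sym e₃))

  oneOf-¬left : {w u v : A} → OneOf w u v → w ≢ u → w ≡ v
  oneOf-¬left (inj₁ w≡u) w≢u = ⊥-elim (w≢u w≡u)
  oneOf-¬left (inj₂ w≡v) _ = w≡v

  oneOf-forced : {w x u v : A} → OneOf w x u → OneOf w x v → u ≢ v → w ≡ x
  oneOf-forced (inj₁ w≡x) _ _ = w≡x
  oneOf-forced (inj₂ _) (inj₁ w≡x) _ = w≡x
  oneOf-forced (inj₂ w≡u) (inj₂ w≡v) u≢v = ⊥-elim (u≢v (trans (sym w≡u) w≡v))

  oneOf-of-implication : {q p x y : A} → q ≢ p → OneOf x q p → OneOf y q p →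
                         (x ≡ q → y ≡ q) → OneOf y x q
  oneOf-of-implication _ _ (inj₁ y≡q) _ = inj₂ y≡q
  oneOf-of-implication _ (inj₂ x≡p) (inj₂ y≡p) _ = inj₁ (trans y≡p (sym x≡p))
  oneOf-of-implication q≢p (inj₁ x≡q) (inj₂ y≡p) x≡q⇒y≡q =
    ⊥-elim (q≢p (trans (sym (x≡q⇒y≡q x≡q)) y≡p))

adjacent⇒distinct : (G : Graph) {x y : V G} → E G x y → x ≢ y
adjacent⇒distinct G e refl = irrefl G e

Agree : {A : ℕ → Set} → ((n : ℕ) → A n) → ((n : ℕ) → A n) → Subset
Agree x y n = x n ≡ y n

module _ (em : ExcludedMiddle 0ℓ) where

  private
    dne : {P : Set} → ¬ ¬ P → P
    dne = em⇒dne em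

  by-cases : {P R : Set} → (P → R) → (¬ P → R) → R
  by-cases f g = [ f , g ]′ (toSum em)

  splice : {A : ℕ → Set} → Subset → ((n : ℕ) → A n) → ((n : ℕ) → A n) → (n : ℕ) → A n
  splice S x y n with em {S n}
  ... | yes _ = x n
  ... | no _ = y n

  module _ {A : ℕ → Set} {S : Subset} {x y : (n : ℕ) → A n} {n : ℕ} where

    splice-in : S n → splice S x y n ≡ x n
    splice-in s with em {S n}
    ... | yes _ = refl
    ... | no ¬s = ⊥-elim (¬s s)

    splice-out : ¬ S n → splice S x y n ≡ y n
    splice-out ¬s with em {S n}
    ... | yes s = ⊥-elim (¬s s)
    ... | no _ = refl

    splice-oneOf : OneOf (splice S x y n) (x n) (y n)
    splice-oneOf = by-cases (inj₁ ∘ splice-in) (inj₂ ∘ splice-out)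

  splice-self-agreement : {A : ℕ → Set} {x q p : (n : ℕ) → A n} {n : ℕ} →
                          OneOf (x n) (q n) (p n) → splice (Agree x q) q p n ≡ x n
  splice-self-agreement x∈qp =
    by-cases (λ x≡q → trans (splice-in x≡q) (sym x≡q))
             (λ x≢q → trans (splice-out x≢q) (sym (oneOf-¬left x∈qp x≢q)))

  module ModIdeal {K : Pred Subset 0ℓ} (isK : IsIdeal K) where
    open IsIdeal isK

    private
      variable
        A : ℕ → Set
        P Q S T W X Y : Subset

    -- Definitionally, AE (Agree x y) is x ∼ y and AE (λ n → E (M n) (x n) (y n)) is Eᴾ M K x y.
    AE : Subset → Set
    AE P = K (∁ P)

    ae-all : (∀ n → P n) → AE P
    ae-all p = downward (λ {n} ¬p → ¬p (p n)) empty

    ae-map : P ⊆ Q → AE P → AE Q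
    ae-map P⊆Q = downward (λ ¬q p → ¬q (P⊆Q p))

    ae-∩ : AE P → AE Q → AE (P ∩ Q)
    ae-∩ {P} {Q} aP aQ = downward split (union aP aQ)
      where
      split : ∁ (P ∩ Q) ⊆ ∁ P ∪ ∁ Q
      split {n} ¬pq with em {P n}
      ... | yes p = inj₂ (λ q → ¬pq (p , q))
      ... | no ¬p = inj₁ ¬p

    ae-map₂ : {R : Subset} → P ∩ Q ⊆ R → AE P → AE Q → AE R
    ae-map₂ f aP aQ = ae-map f (ae-∩ aP aQ)

    ≤⇒ae : S ≤[ K ] T → AE (S ⇒ T)
    ≤⇒ae = downward (λ ¬s⇒t → dne (λ ¬s → ¬s⇒t (⊥-elim ∘ ¬s)) , λ t → ¬s⇒t (λ _ → t))

    ae⇒≤ : AE (S ⇒ T) → S ≤[ K ] T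
    ae⇒≤ = downward (λ (s , ¬t) s⇒t → ¬t (s⇒t s))

    ⊆⇒≤ : S ⊆ T → S ≤[ K ] T
    ⊆⇒≤ S⊆T = ae⇒≤ (ae-all (λ _ → S⊆T))

    ≤-trans : S ≤[ K ] T → T ≤[ K ] W → S ≤[ K ] W
    ≤-trans S≤T T≤W = ae⇒≤ (ae-map₂ (λ (f , g) → g ∘ f) (≤⇒ae S≤T) (≤⇒ae T≤W))

    ≤-antisym : S ≤[ K ] T → T ≤[ K ] S → S ≈[ K ] T
    ≤-antisym = union

    ≈⇒≤ : S ≈[ K ] T → S ≤[ K ] T
    ≈⇒≤ = downward inj₁

    ≈⇒≥ : S ≈[ K ] T → T ≤[ K ] S
    ≈⇒≥ = downward inj₂

    ≈-sym : S ≈[ K ] T → T ≈[ K ] S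
    ≈-sym S≈T = ≤-antisym (≈⇒≥ S≈T) (≈⇒≤ S≈T)

    ≈-trans : S ≈[ K ] T → T ≈[ K ] W → S ≈[ K ] W
    ≈-trans S≈T T≈W = ≤-antisym (≤-trans (≈⇒≤ S≈T) (≈⇒≤ T≈W)) (≤-trans (≈⇒≥ T≈W) (≈⇒≥ S≈T))

    ≤-resp-≈ : S ≈[ K ] X → T ≈[ K ] Y → S ≤[ K ] T → X ≤[ K ] Y
    ≤-resp-≈ S≈X T≈Y S≤T = ≤-trans (≈⇒≥ S≈X) (≤-trans S≤T (≈⇒≤ T≈Y))

    ∪-least : S ≤[ K ] W → T ≤[ K ] W → (S ∪ T) ≤[ K ] W
    ∪-least S≤W T≤W = ae⇒≤ (ae-map₂ (λ (f , g) → [ f , g ]′) (≤⇒ae S≤W) (≤⇒ae T≤W))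

    ∩-greatest : W ≤[ K ] S → W ≤[ K ] T → W ≤[ K ] (S ∩ T)
    ∩-greatest W≤S W≤T = ae⇒≤ (ae-map₂ (λ (f , g) w → f w , g w) (≤⇒ae W≤S) (≤⇒ae W≤T))

    complement-unique : (X ∩ Y) ≤[ K ] ∅ → U ≤[ K ] (X ∪ Y) → Y ≈[ K ] ∁ X
    complement-unique disjoint covering = ≤-antisym
      (ae⇒≤ (ae-map (λ f y x → f (x , y)) (≤⇒ae disjoint)))
      (ae⇒≤ (ae-map (λ f ¬x → [ ⊥-elim ∘ ¬x , id ]′ (f tt)) (≤⇒ae covering)))

    agree-sym : {x y : (n : ℕ) → A n} → AE (Agree x y) → AE (Agree y x)
    agree-sym = ae-map sym

    agree-resp : {x x′ y : (n : ℕ) → A n} → AE (Agree x x′) → Agree x y ≈[ K ] Agree x′ y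
    agree-resp x=x′ = ≤-antisym (ae⇒≤ (ae-map (λ e → trans (sym e)) x=x′))
                                (ae⇒≤ (ae-map trans x=x′))

    agree-splice : {q p : (n : ℕ) → A n} → AE (λ n → q n ≢ p n) →
                   Agree (splice S q p) q ≈[ K ] S
    agree-splice q≢p = ≤-antisym
      (ae⇒≤ (ae-map (λ q≢p z≡q → dne (λ ¬s → q≢p (trans (sym z≡q) (splice-out ¬s)))) q≢p))
      (⊆⇒≤ splice-in)

    OneOfᴾ : (c a b : (n : ℕ) → A n) → Set
    OneOfᴾ c a b = AE (λ n → OneOf (c n) (a n) (b n))

    oneOf-resp : {a b c c′ : (n : ℕ) → A n} → AE (Agree c c′) → OneOfᴾ c a b → OneOfᴾ c′ a b
    oneOf-resp = ae-map₂ (λ (c≡c′ , c∈ab) → subst (λ w → OneOf w _ _) c≡c′ c∈ab)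

    oneOf⇒agree-≤ : {x y q : (n : ℕ) → A n} → OneOfᴾ y x q → Agree x q ≤[ K ] Agree y q
    oneOf⇒agree-≤ = ae⇒≤ ∘ ae-map (λ y∈xq x≡q → [ (λ y≡x → trans y≡x x≡q) , id ]′ y∈xq)

    agree-≤⇒oneOf : {x y q p : (n : ℕ) → A n} → AE (λ n → q n ≢ p n) →
                    OneOfᴾ x q p → OneOfᴾ y q p → Agree x q ≤[ K ] Agree y q → OneOfᴾ y x q
    agree-≤⇒oneOf q≢p x∈qp y∈qp x≤y =
      ae-map (λ (q≢p , x∈qp , y∈qp , x≡q⇒y≡q) → oneOf-of-implication q≢p x∈qp y∈qp x≡q⇒y≡q)
             (ae-∩ q≢p (ae-∩ x∈qp (ae-∩ y∈qp (≤⇒ae x≤y))))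

  module _ {I J : Pred Subset 0ℓ} (isI : IsIdeal I) (isJ : IsIdeal J) {α : Subset → Subset}
           (α-mono : ∀ {S T} → S ≤[ I ] T → α S ≤[ J ] α T)
           (α-reflect : ∀ {S T} → α S ≤[ J ] α T → S ≤[ I ] T)
           (α-onto : ∀ T → Σ Subset λ S → α S ≈[ J ] T) where

    private
      module 𝕀 = ModIdeal isI
      module 𝕁 = ModIdeal isJ

      α-bottom : α ∅ ≤[ J ] ∅
      α-bottom = let (S , αS≈∅) = α-onto ∅ in 𝕁.≤-trans (α-mono (𝕀.⊆⇒≤ λ ())) (𝕁.≈⇒≤ αS≈∅)

      α-top : U ≤[ J ] α U
      α-top = let (S , αS≈U) = α-onto U in 𝕁.≤-trans (𝕁.≈⇒≥ αS≈U) (α-mono (𝕀.⊆⇒≤ _))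

      α-∪ : ∀ S T → α (S ∪ T) ≈[ J ] (α S ∪ α T)
      α-∪ S T = 𝕁.≤-antisym (𝕁.≤-trans (α-mono S∪T≤W) (𝕁.≈⇒≤ αW≈))
                            (𝕁.∪-least (α-mono (𝕀.⊆⇒≤ inj₁)) (α-mono (𝕀.⊆⇒≤ inj₂)))
        where
        W : Subset
        W = proj₁ (α-onto (α S ∪ α T))
        αW≈ : α W ≈[ J ] (α S ∪ α T)
        αW≈ = proj₂ (α-onto (α S ∪ α T))
        S∪T≤W : (S ∪ T) ≤[ I ] W
        S∪T≤W = 𝕀.∪-least (α-reflect (𝕁.≤-trans (𝕁.⊆⇒≤ inj₁) (𝕁.≈⇒≥ αW≈)))
                          (α-reflect (𝕁.≤-trans (𝕁.⊆⇒≤ inj₂) (𝕁.≈⇒≥ αW≈)))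

      α-∁ : ∀ S → α (∁ S) ≈[ J ] ∁ (α S)
      α-∁ S = 𝕁.complement-unique disjoint covering
        where
        W : Subset
        W = proj₁ (α-onto (α S ∩ α (∁ S)))
        αW≈ : α W ≈[ J ] (α S ∩ α (∁ S))
        αW≈ = proj₂ (α-onto (α S ∩ α (∁ S)))
        W≤∅ : W ≤[ I ] ∅
        W≤∅ = 𝕀.≤-trans (𝕀.∩-greatest (α-reflect (𝕁.≤-trans (𝕁.≈⇒≤ αW≈) (𝕁.⊆⇒≤ proj₁)))
                                      (α-reflect (𝕁.≤-trans (𝕁.≈⇒≤ αW≈) (𝕁.⊆⇒≤ proj₂))))
                        (𝕀.⊆⇒≤ λ (s , ¬s) → ¬s s)
        disjoint : (α S ∩ α (∁ S)) ≤[ J ] ∅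
        disjoint = 𝕁.≤-trans (𝕁.≈⇒≥ αW≈) (𝕁.≤-trans (α-mono W≤∅) α-bottom)
        excluded-middle : U ≤[ I ] (S ∪ ∁ S)
        excluded-middle = 𝕀.⊆⇒≤ λ _ → by-cases inj₁ inj₂
        covering : U ≤[ J ] (α S ∪ α (∁ S))
        covering = 𝕁.≤-trans α-top (𝕁.≤-trans (α-mono excluded-middle) (𝕁.≈⇒≤ (α-∪ S (∁ S))))

    orderIso⇒isBAIso : IsBAIso I J α
    orderIso⇒isBAIso = record
      { respects   = λ S T S≈T → 𝕁.≤-antisym (α-mono (𝕀.≈⇒≤ S≈T)) (α-mono (𝕀.≈⇒≥ S≈T))
      ; injective  = λ S T αS≈αT → 𝕀.≤-antisym (α-reflect (𝕁.≈⇒≤ αS≈αT)) (α-reflect (𝕁.≈⇒≥ αS≈αT))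
      ; surjective = α-onto
      ; pres-∪     = α-∪
      ; pres-∁     = α-∁
      }

  module SufficientlyRandomGraph {G : Graph} (sr : SufficientlyRandom G) where
    open SufficientlyRandom sr

    ∃-avoiding : (x y : V G) → Σ (V G) λ w → ¬ OneOf w x y
    ∃-avoiding x y with threeVertices
    ... | a₁ , a₂ , a₃ , a₁≢a₂ , a₁≢a₃ , a₂≢a₃
        with em {OneOf a₁ x y} | em {OneOf a₂ x y} | em {OneOf a₃ x y}
    ... | no a₁∉ | _ | _ = a₁ , a₁∉
    ... | yes _ | no a₂∉ | _ = a₂ , a₂∉
    ... | yes _ | yes _ | no a₃∉ = a₃ , a₃∉
    ... | yes a₁∈ | yes a₂∈ | yes a₃∈ = ⊥-elim (no-three-in-pair a₁≢a₂ a₁≢a₃ a₂≢a₃ a₁∈ a₂∈ a₃∈)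

    ∃-separating-neighbour : (x y u : V G) → ¬ OneOf u x y →
                             Σ (V G) λ v → E G v x × E G v y × ¬ E G v u
    ∃-separating-neighbour x y u u∉ with em {x ≡ y}
    ... | no x≢y =
      let (v , _ , ¬uv , vx , vy) = extension x y u x≢y (u∉ ∘ inj₁) (u∉ ∘ inj₂)
      in v , vx , vy , ¬uv ∘ Graph.sym G
    ... | yes refl =
      let (w , w∉) = ∃-avoiding x u
          (v , _ , ¬uv , vx , _) = extension x w u (w∉ ∘ inj₁ ∘ sym) (u∉ ∘ inj₁) (w∉ ∘ inj₂ ∘ sym)
      in v , vx , vx , ¬uv ∘ Graph.sym G

    ∃-common-neighbour : (x y : V G) → Σ (V G) λ v → E G v x × E G v y
    ∃-common-neighbour x y =
      let (u , u∉) = ∃-avoiding x y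
          (v , vx , vy , _) = ∃-separating-neighbour x y u u∉
      in v , vx , vy

    ∃-test-neighbour : (x y z : V G) → Σ (V G) λ v → E G v x × E G v y × (E G v z → OneOf z x y)
    ∃-test-neighbour x y z with em {OneOf z x y}
    ... | yes z∈ = let (v , vx , vy) = ∃-common-neighbour x y in v , vx , vy , λ _ → z∈
    ... | no z∉ =
      let (v , vx , vy , ¬vz) = ∃-separating-neighbour x y z z∉ in v , vx , vy , ⊥-elim ∘ ¬vz

  module GraphProduct (M : ℕ → Graph) {K : Pred Subset 0ℓ} (isK : IsIdeal K) where
    open ModIdeal isK

    Eᴾ⇒apart : {a b : Prod M K} → Eᴾ M K a b → AE (λ n → a n ≢ b n)
    Eᴾ⇒apart = ae-map (adjacent⇒distinct (M _))

    ∃-common-neighbourᴾ : (∀ n → SufficientlyRandom (M n)) → (a b : Prod M K) →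
                          Σ (Prod M K) λ v → Eᴾ M K v a × Eᴾ M K v b
    ∃-common-neighbourᴾ sr a b =
      (λ n → proj₁ (common n)) ,
      ae-all (λ n → proj₁ (proj₂ (common n))) ,
      ae-all (λ n → proj₂ (proj₂ (common n)))
      where
      common : ∀ n → Σ (V (M n)) λ v → E (M n) v (a n) × E (M n) v (b n)
      common n = SufficientlyRandomGraph.∃-common-neighbour (sr n) (a n) (b n)

    CommonNbrsAdj : (c a b : Prod M K) → Set
    CommonNbrsAdj c a b = ∀ v → Eᴾ M K v a → Eᴾ M K v b → Eᴾ M K v c

    Eᴾ-respˡ : {a a′ b : Prod M K} → AE (Agree a a′) → Eᴾ M K a b → Eᴾ M K a′ b
    Eᴾ-respˡ {b = b} = ae-map₂ (λ {n} (a≡a′ , e) → subst (λ w → E (M n) w (b n)) a≡a′ e)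

    oneOf⇒commonNbrsAdj : {c a b : Prod M K} → OneOfᴾ c a b → CommonNbrsAdj c a b
    oneOf⇒commonNbrsAdj {c} {a} {b} c∈ab v va vb =
      ae-map (λ {n} (c∈ab , va , vb) → [ (λ c≡a → subst (E (M n) (v n)) (sym c≡a) va)
                                       , (λ c≡b → subst (E (M n) (v n)) (sym c≡b) vb) ]′ c∈ab)
             (ae-∩ c∈ab (ae-∩ va vb))

    commonNbrsAdj⇒oneOf : (∀ n → SufficientlyRandom (M n)) →
                          {c a b : Prod M K} → CommonNbrsAdj c a b → OneOfᴾ c a b
    commonNbrsAdj⇒oneOf sr {c} {a} {b} adj =
      ae-map (λ {n} → proj₂ (proj₂ (proj₂ (test n)))) (adj v (ae-all v-adj-a) (ae-all v-adj-b))
      where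
      test : ∀ n → Σ (V (M n)) λ v →
               E (M n) v (a n) × E (M n) v (b n) × (E (M n) v (c n) → OneOf (c n) (a n) (b n))
      test n = SufficientlyRandomGraph.∃-test-neighbour (sr n) (a n) (b n) (c n)
      v : Prod M K
      v n = proj₁ (test n)
      v-adj-a : ∀ n → E (M n) (v n) (a n)
      v-adj-a n = proj₁ (proj₂ (test n))
      v-adj-b : ∀ n → E (M n) (v n) (b n)
      v-adj-b n = proj₁ (proj₂ (proj₂ (test n)))

  module Isomorphism {I J : Pred Subset 0ℓ} (isI : IsIdeal I) (isJ : IsIdeal J)
                     {M N : ℕ → Graph}
                     (srM : ∀ n → SufficientlyRandom (M n)) (srN : ∀ n → SufficientlyRandom (N n))
                     {Φ : Prod M I → Prod N J} (iso : IsIsoRP M N I J Φ) where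
    open IsIsoRP iso
    private
      module 𝕀 = ModIdeal isI
      module 𝕁 = ModIdeal isJ
      module ℳ = GraphProduct M isI
      module 𝒩 = GraphProduct N isJ

    oneOf-preserved : {c a b : Prod M I} → 𝕀.OneOfᴾ c a b → 𝕁.OneOfᴾ (Φ c) (Φ a) (Φ b)
    oneOf-preserved {c} {a} {b} c∈ab = 𝒩.commonNbrsAdj⇒oneOf srN λ v va vb →
      let (x , Φx∼v) = surjective v
          v∼Φx = 𝕁.agree-sym Φx∼v
      in 𝒩.Eᴾ-respˡ Φx∼v
           (preservesE x c (ℳ.oneOf⇒commonNbrsAdj c∈ab x (reflectsE x a (𝒩.Eᴾ-respˡ v∼Φx va))
                                                       (reflectsE x b (𝒩.Eᴾ-respˡ v∼Φx vb))))

    oneOf-reflected : {c a b : Prod M I} → 𝕁.OneOfᴾ (Φ c) (Φ a) (Φ b) → 𝕀.OneOfᴾ c a b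
    oneOf-reflected {c} {a} {b} Φc∈ΦaΦb = ℳ.commonNbrsAdj⇒oneOf srM λ v va vb →
      reflectsE v c (𝒩.oneOf⇒commonNbrsAdj Φc∈ΦaΦb (Φ v) (preservesE v a va) (preservesE v b vb))

  module Coordinates {I J : Pred Subset 0ℓ} (isI : IsIdeal I) (isJ : IsIdeal J)
                     {M N : ℕ → Graph}
                     (srM : ∀ n → SufficientlyRandom (M n)) (srN : ∀ n → SufficientlyRandom (N n))
                     {Φ : Prod M I → Prod N J} (iso : IsIsoRP M N I J Φ) where
    open IsIsoRP iso
    open Isomorphism isI isJ srM srN iso
    private
      module 𝕀 = ModIdeal isI
      module 𝕁 = ModIdeal isJ
      module ℳ = GraphProduct M isI
      module 𝒩 = GraphProduct N isJ

    Φ-apart : {x y : Prod M I} → Eᴾ M I x y → 𝕁.AE (λ n → Φ x n ≢ Φ y n)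
    Φ-apart = 𝒩.Eᴾ⇒apart ∘ preservesE _ _

    p : Prod M I
    p n = proj₁ (SufficientlyRandom.threeVertices (srM n))

    q : Prod M I
    q = proj₁ (ℳ.∃-common-neighbourᴾ srM p p)

    q-adj-p : Eᴾ M I q p
    q-adj-p = proj₁ (proj₂ (ℳ.∃-common-neighbourᴾ srM p p))

    χ : Subset → Prod M I
    χ S = splice S q p

    χ-oneOf : ∀ S → 𝕀.OneOfᴾ (χ S) q p
    χ-oneOf S = 𝕀.ae-all λ _ → splice-oneOf

    χ-agree : ∀ S → Agree (χ S) q ≈[ I ] S
    χ-agree S = 𝕀.agree-splice (ℳ.Eᴾ⇒apart q-adj-p)

    α : Subset → Subset
    α S = Agree (Φ (χ S)) (Φ q)

    α-mono : ∀ {S T} → S ≤[ I ] T → α S ≤[ J ] α T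
    α-mono {S} {T} S≤T =
      𝕁.oneOf⇒agree-≤ (oneOf-preserved (𝕀.agree-≤⇒oneOf (ℳ.Eᴾ⇒apart q-adj-p) (χ-oneOf S) (χ-oneOf T)
        (𝕀.≤-resp-≈ (𝕀.≈-sym (χ-agree S)) (𝕀.≈-sym (χ-agree T)) S≤T)))

    α-reflect : ∀ {S T} → α S ≤[ J ] α T → S ≤[ I ] T
    α-reflect {S} {T} αS≤αT =
      𝕀.≤-resp-≈ (χ-agree S) (χ-agree T)
        (𝕀.oneOf⇒agree-≤ (oneOf-reflected (𝕁.agree-≤⇒oneOf (Φ-apart q-adj-p)
          (oneOf-preserved (χ-oneOf S)) (oneOf-preserved (χ-oneOf T)) αS≤αT)))

    α-onto : ∀ T → Σ Subset λ S → α S ≈[ J ] T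
    α-onto T = Agree x q , αS≈T
      where
      y : Prod N J
      y = splice T (Φ q) (Φ p)
      x : Prod M I
      x = proj₁ (surjective y)
      Φx∼y : _∼_ N J (Φ x) y
      Φx∼y = proj₂ (surjective y)
      x∈qp : 𝕀.OneOfᴾ x q p
      x∈qp = oneOf-reflected (𝕁.oneOf-resp (𝕁.agree-sym Φx∼y) (𝕁.ae-all λ _ → splice-oneOf))
      χS∼x : _∼_ M I (χ (Agree x q)) x
      χS∼x = 𝕀.ae-map splice-self-agreement x∈qp
      αS≈T : α (Agree x q) ≈[ J ] T
      αS≈T = 𝕁.≈-trans (𝕁.agree-resp (respects _ _ χS∼x))
               (𝕁.≈-trans (𝕁.agree-resp Φx∼y) (𝕁.agree-splice (Φ-apart q-adj-p)))

    ΦSpliceAgrees : Subset → Prod M I → Prod M I → Set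
    ΦSpliceAgrees S x y = 𝕁.AE (α S ⇒ Agree (Φ (splice S x y)) (Φ x))

    ΦSpliceAgrees-first : ∀ {S x y} x′ → Eᴾ M I x y → ΦSpliceAgrees S x y → ΦSpliceAgrees S x′ y
    ΦSpliceAgrees-first {S} {x} {y} x′ x-adj-y agrees =
      𝕁.ae-map (λ (agrees , Φx≢Φy , o₁ , o₂) αS →
                  oneOf-forced o₁ o₂ (λ Φw≡Φy → Φx≢Φy (trans (sym (agrees αS)) Φw≡Φy)))
               (𝕁.ae-∩ agrees (𝕁.ae-∩ (Φ-apart x-adj-y)
                 (𝕁.ae-∩ (oneOf-preserved w′∈x′w) (oneOf-preserved (𝕀.ae-all λ _ → splice-oneOf)))))
      where
      w′∈x′w : 𝕀.OneOfᴾ (splice S x′ y) x′ (splice S x y)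
      w′∈x′w = 𝕀.ae-all λ _ →
        by-cases (inj₁ ∘ splice-in) (λ ¬s → inj₂ (trans (splice-out ¬s) (sym (splice-out ¬s))))

    ΦSpliceAgrees-second : ∀ {S x y} y′ → Eᴾ M I x y → ΦSpliceAgrees S x y → ΦSpliceAgrees S x y′
    ΦSpliceAgrees-second {S} {x} {y} y′ x-adj-y agrees =
      𝕁.ae-map (λ (agrees , Φx≢Φy , o) αS →
                  trans (sym (oneOf-¬left o (λ Φw≡Φy → Φx≢Φy (trans (sym (agrees αS)) Φw≡Φy))))
                        (agrees αS))
               (𝕁.ae-∩ agrees (𝕁.ae-∩ (Φ-apart x-adj-y) (oneOf-preserved w∈yw′)))
      where
      w∈yw′ : 𝕀.OneOfᴾ (splice S x y) y (splice S x y′)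
      w∈yw′ = 𝕀.ae-all λ _ →
        by-cases (λ s → inj₂ (trans (splice-in s) (sym (splice-in s)))) (inj₁ ∘ splice-out)

    ΦSpliceAgrees-all : ∀ S a b → ΦSpliceAgrees S a b
    ΦSpliceAgrees-all S a b =
      let (t , t-adj-p , t-adj-b) = ℳ.∃-common-neighbourᴾ srM p b
      in ΦSpliceAgrees-first a t-adj-b (ΦSpliceAgrees-second b t-adj-p
           (ΦSpliceAgrees-first t q-adj-p (𝕁.ae-all λ _ → id)))

    coordinate-respecting : ∀ a b S → EqOn M I S a b → EqOn N J (α S) (Φ a) (Φ b)
    coordinate-respecting a b S a=b =
      𝕁.ae⇒≤ (𝕁.ae-map₂ (λ (agrees , Φh≡Φb) αS → trans (sym (agrees αS)) Φh≡Φb)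
                        (ΦSpliceAgrees-all S a b) (respects _ _ h∼b))
      where
      h∼b : _∼_ M I (splice S a b) b
      h∼b = 𝕀.ae-map (λ a≡b → by-cases (λ s → trans (splice-in s) (a≡b s)) splice-out)
                     (𝕀.≤⇒ae a=b)

proposition2p22 : ExcludedMiddle 0ℓ → RecognizesCoordinatesSR
proposition2p22 em I J isI isJ _ _ M N srM srN Φ iso =
  α , orderIso⇒isBAIso em isI isJ α-mono α-reflect α-onto , coordinate-respecting
  where open Coordinates em isI isJ srM srN iso
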